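{- For $n\ge0$, $c\ge1$ and positive integers $a_1,\dots,a_n$, \[ \sum_{i=0}^{n}f_c\big(S(x_{a_{i+1}}\cdots x_{a_n}),\,x_{a_1}\cdots x_{a_i}\big)=\begin{cases}x_{c+a_1+\cdots+a_n}& n\text{ even}\\0& n\text{ odd}.\end{cases} \]
   Context: $\mathfrak X=\mathbb Q\langle x_1,x_2,\dots\rangle$ is the free non-commutative $\mathbb Q$-algebra. $S$ is the anti-automorphism of $\mathfrak X$ with $S(x_k)=-x_k$. For $c\ge1$, $f_c:\mathfrak X\times\mathfrak X\to\mathfrak X$ are the $\mathbb Q$-bilinear maps determined recursively by $f_c(u,1)=f_c(1,u)=x_cu$ and $f_c(x_au,x_bv)=x_cf_a(u,x_bv)+x_cf_b(x_au,v)-f_{c+a+b}(u,v)$ for $u,v\in\mathfrak X$, $a,b\ge1$. -}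

module Defs where

open import Data.Nat using (ℕ; zero; suc; _+_)
open import Data.List using (List; []; _∷_; _++_; map; reverse; length; take; drop; foldr)
open import Data.List.Properties using (≡-dec)
open import Data.Product using (_×_; _,_)
open import Data.Rational using (ℚ; 0ℚ; 1ℚ; -_) renaming (_+_ to _+ℚ_; _*_ to _*ℚ_)
open import Relation.Binary.PropositionalEquality using (_≡_)
open import Relation.Nullary using (yes; no)
import Data.Nat as ℕ

-- ENCODING: the generator x_k (k ≥ 1) of 𝔛 is encoded by the natural number
-- k - 1.  So a letter `a : ℕ` stands for x_{suc a}.  Addition of positive
-- indices becomes _⊕_ : (suc a) + (suc b) = suc (a ⊕ b).
Letter : Set
Letter = ℕ

_⊕_ : Letter → Letter → Letter
a ⊕ b = suc (a + b)

Word : Set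
Word = List Letter

-- Elements of 𝔛 = ℚ⟨x_1,x_2,…⟩ : finite formal ℚ-linear combinations of words,
-- identified up to the equivalence _≈_ (equal coefficient for every word).
𝔛 : Set
𝔛 = List (ℚ × Word)

coeff : 𝔛 → Word → ℚ
coeff [] w = 0ℚ
coeff ((q , u) ∷ p) w with ≡-dec ℕ._≟_ u w
... | yes _ = q +ℚ coeff p w
... | no  _ = coeff p w

infix 4 _≈_
_≈_ : 𝔛 → 𝔛 → Set
p ≈ q = ∀ w → coeff p w ≡ coeff q w

𝟘 : 𝔛
𝟘 = []

mono : Word → 𝔛
mono w = (1ℚ , w) ∷ []

infixl 6 _⊞_ _⊟_
_⊞_ : 𝔛 → 𝔛 → 𝔛
p ⊞ q = p ++ q

⊟_ : 𝔛 → 𝔛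
⊟ p = map (λ { (q , w) → (- q , w) }) p

_⊟_ : 𝔛 → 𝔛 → 𝔛
p ⊟ q = p ⊞ (⊟ q)

xmul : Letter → 𝔛 → 𝔛
xmul a p = map (λ { (q , w) → (q , a ∷ w) }) p

-- S : anti-automorphism with S(x_k) = -x_k, on a word:
-- S(x_{a1}⋯x_{am}) = (-1)^m x_{am}⋯x_{a1}
signW : Word → ℚ
signW [] = 1ℚ
signW (_ ∷ w) = - signW w

S : 𝔛 → 𝔛
S [] = []
S ((q , w) ∷ p) = (q *ℚ signW w , reverse w) ∷ S p

-- f_c on pairs of words (c encoded as a letter, i.e. stands for f_{suc c}):
--   f_c(u,1) = f_c(1,u) = x_c u
--   f_c(x_a u, x_b v) = x_c f_a(u, x_b v) + x_c f_b(x_a u, v) - f_{c+a+b}(u,v)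
fw : Letter → Word → Word → 𝔛
fw c [] v = mono (c ∷ v)
fw c (a ∷ u) [] = mono (c ∷ a ∷ u)
fw c (a ∷ u) (b ∷ v) =
  xmul c (fw a u (b ∷ v)) ⊞ xmul c (fw b (a ∷ u) v) ⊟ fw ((c ⊕ a) ⊕ b) u v

scale : ℚ → 𝔛 → 𝔛
scale t = map (λ { (s , w) → (t *ℚ s , w) })

f : Letter → 𝔛 → 𝔛 → 𝔛
f c [] q = []
f c ((r , u) ∷ p) q = fl q ⊞ f c p q
  where
  fl : 𝔛 → 𝔛
  fl [] = []
  fl ((s , v) ∷ q′) = scale (r *ℚ s) (fw c u v) ⊞ fl q′

sumUpTo : ℕ → (ℕ → 𝔛) → 𝔛
sumUpTo zero g = g zero
sumUpTo (suc n) g = sumUpTo n g ⊞ g (suc n)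

-- Write Σ_c(w) for the left-hand side: a sum over the splittings w = u v of
-- (−1)^|v| f_c(reverse v, u).  For w = q m p, expanding every splitting with u and v
-- nonempty by the defining recursion of f_c gives
--   Σ_c(q m p) = x_c Σ_q(m p) − x_c Σ_p(q m) + Σ_{c+p+q}(m),
-- where the two splittings with u or v empty supply exactly the terms of x_c Σ_q(m p)
-- and x_c Σ_p(q m) not produced by the expansion.  The words q m and m p have the same
-- length and index sum, so by induction the first two summands cancel, and the length
-- drops by two while the index sum is unchanged.
module Submission where

open import Defs
open import Data.Nat using (ℕ; zero; suc; _%_; _≤_; z≤n; s≤s) renaming (_+_ to _ℕ+_)
import Data.Nat.Properties as ℕ
import Data.Nat.Tactic.RingSolver as ℕ-Solver
open import Data.List using (List; []; _∷_; _∷ʳ_; length; take; drop; foldr; reverse)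
import Data.List.Properties as List
open import Data.List.Properties using (≡-dec)
open import Data.List.Reverse using (Reverse; reverseView; []; _∶_∶ʳ_)
open import Data.Product using (_×_; _,_)
open import Data.Rational using (ℚ; 0ℚ; 1ℚ; _+_; _*_; -_)
open import Data.Rational.Properties
  using (+-assoc; +-identityˡ; +-inverseˡ; *-identityˡ; *-identityʳ; *-distribˡ-+;
         neg-distrib-+; neg-distribˡ-*; *-zeroʳ; +-inverseʳ; +-*-commutativeRing)
open import Data.Empty using (⊥-elim)
open import Data.Maybe using (nothing)
open import Relation.Binary.Bundles using (Setoid)
open import Relation.Binary.PropositionalEquality
  using (_≡_; _≢_; refl; sym; trans; cong; cong₂; module ≡-Reasoning)
open import Relation.Nullary using (Dec; yes; no)
open import Function using (_∘_)
import Relation.Binary.Reasoning.Setoid as SetoidReasoning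
open import Tactic.RingSolver using (solve-∀)
open import Tactic.RingSolver.Core.AlmostCommutativeRing
  using (AlmostCommutativeRing; fromCommutativeRing)

ℚ-ring : AlmostCommutativeRing _ _
ℚ-ring = fromCommutativeRing +-*-commutativeRing (λ _ → nothing)

coeff-∷-≡ : ∀ q u w p → u ≡ w → coeff ((q , u) ∷ p) w ≡ q + coeff p w
coeff-∷-≡ q u w p u≡w with ≡-dec ℕ._≟_ u w
... | yes _   = refl
... | no u≢w  = ⊥-elim (u≢w u≡w)

coeff-∷-≢ : ∀ q u w p → u ≢ w → coeff ((q , u) ∷ p) w ≡ coeff p w
coeff-∷-≢ q u w p u≢w with ≡-dec ℕ._≟_ u w
... | yes u≡w = ⊥-elim (u≢w u≡w)
... | no _    = refl

coeff-⊞ : ∀ p r w → coeff (p ⊞ r) w ≡ coeff p w + coeff r w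
coeff-⊞ []            r w = sym (+-identityˡ _)
coeff-⊞ ((q , u) ∷ p) r w with ≡-dec ℕ._≟_ u w
... | yes _ = trans (cong (q +_) (coeff-⊞ p r w)) (sym (+-assoc q _ _))
... | no _  = coeff-⊞ p r w

coeff-neg : ∀ p w → coeff (⊟ p) w ≡ - coeff p w
coeff-neg []            w = refl
coeff-neg ((q , u) ∷ p) w with ≡-dec ℕ._≟_ u w
... | yes _ = trans (cong (- q +_) (coeff-neg p w)) (sym (neg-distrib-+ q _))
... | no _  = coeff-neg p w

coeff-scale : ∀ t p w → coeff (scale t p) w ≡ t * coeff p w
coeff-scale t []            w = sym (*-zeroʳ t)
coeff-scale t ((q , u) ∷ p) w with ≡-dec ℕ._≟_ u w
... | yes _ = trans (cong (t * q +_) (coeff-scale t p w)) (sym (*-distribˡ-+ t q _))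
... | no _  = coeff-scale t p w

coeff-⊟ : ∀ p r w → coeff (p ⊟ r) w ≡ coeff p w + - coeff r w
coeff-⊟ p r w = trans (coeff-⊞ p (⊟ r) w) (cong (coeff p w +_) (coeff-neg r w))

-- _≈_ unfolds to a Π-type, hiding the polynomials it relates from unification.
infix 4 _≋_
record _≋_ (p r : 𝔛) : Set where
  field coeff-≡ : p ≈ r
open _≋_ public

≋-refl : ∀ {p} → p ≋ p
≋-refl .coeff-≡ _ = refl

≋-reflexive : ∀ {p r} → p ≡ r → p ≋ r
≋-reflexive refl = ≋-refl

≋-sym : ∀ {p r} → p ≋ r → r ≋ p
≋-sym p≋r .coeff-≡ w = sym (p≋r .coeff-≡ w)

≋-trans : ∀ {p r s} → p ≋ r → r ≋ s → p ≋ s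
≋-trans p≋r r≋s .coeff-≡ w = trans (p≋r .coeff-≡ w) (r≋s .coeff-≡ w)

≋-setoid : Setoid _ _
≋-setoid = record
  { Carrier       = 𝔛
  ; _≈_           = _≋_
  ; isEquivalence = record { refl = ≋-refl ; sym = ≋-sym ; trans = ≋-trans }
  }

module ≋-Reasoning = SetoidReasoning ≋-setoid

⊞-cong : ∀ {p p′ r r′} → p ≋ p′ → r ≋ r′ → p ⊞ r ≋ p′ ⊞ r′
⊞-cong {p} {p′} {r} {r′} p≋p′ r≋r′ .coeff-≡ w =
  trans (coeff-⊞ p r w) (trans (cong₂ _+_ (p≋p′ .coeff-≡ w) (r≋r′ .coeff-≡ w)) (sym (coeff-⊞ p′ r′ w)))

scale-neg : ∀ t p → scale (- t) p ≋ ⊟ scale t p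
scale-neg t p .coeff-≡ w = begin
  coeff (scale (- t) p) w   ≡⟨ coeff-scale (- t) p w ⟩
  - t * coeff p w           ≡⟨ neg-distribˡ-* t _ ⟨
  - (t * coeff p w)         ≡⟨ cong -_ (coeff-scale t p w) ⟨
  - coeff (scale t p) w     ≡⟨ coeff-neg (scale t p) w ⟨
  coeff (⊟ scale t p) w     ∎
  where open ≡-Reasoning

⊞-inverseˡ : ∀ p → ⊟ p ⊞ p ≋ 𝟘
⊞-inverseˡ p .coeff-≡ w =
  trans (coeff-⊞ (⊟ p) p w) (trans (cong (_+ coeff p w) (coeff-neg p w)) (+-inverseˡ (coeff p w)))

⊟-cancelˡ : ∀ {p r} s → r ≋ p → (r ⊟ p) ⊞ s ≋ s
⊟-cancelˡ {p} {r} s r≋p .coeff-≡ w = begin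
  coeff ((r ⊟ p) ⊞ s) w                     ≡⟨ coeff-⊞ (r ⊟ p) s w ⟩
  coeff (r ⊟ p) w + coeff s w               ≡⟨ cong (_+ coeff s w) (coeff-⊟ r p w) ⟩
  (coeff r w + - coeff p w) + coeff s w     ≡⟨ cong (λ x → (x + - coeff p w) + coeff s w) (r≋p .coeff-≡ w) ⟩
  (coeff p w + - coeff p w) + coeff s w     ≡⟨ cong (_+ coeff s w) (+-inverseʳ (coeff p w)) ⟩
  0ℚ + coeff s w                            ≡⟨ +-identityˡ (coeff s w) ⟩
  coeff s w                                 ∎
  where open ≡-Reasoning

scale-neg-regroup : ∀ t x y z → scale (- t) ((x ⊞ y) ⊟ z) ≋ (scale (- t) y ⊟ scale t x) ⊞ scale t z
scale-neg-regroup t x y z .coeff-≡ w = begin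
  coeff (scale (- t) ((x ⊞ y) ⊟ z)) w
    ≡⟨ coeff-scale (- t) ((x ⊞ y) ⊟ z) w ⟩
  - t * coeff ((x ⊞ y) ⊟ z) w
    ≡⟨ cong (- t *_) (trans (coeff-⊟ (x ⊞ y) z w) (cong (_+ - Z) (coeff-⊞ x y w))) ⟩
  - t * ((X + Y) + - Z)
    ≡⟨ ring t X Y Z ⟩
  (- t * Y + - (t * X)) + t * Z
    ≡⟨ cong₂ (λ u v → (u + - v) + t * Z) (coeff-scale (- t) y w) (coeff-scale t x w) ⟨
  (coeff (scale (- t) y) w + - coeff (scale t x) w) + t * Z
    ≡⟨ cong₂ _+_ (coeff-⊟ (scale (- t) y) (scale t x) w) (coeff-scale t z w) ⟨
  coeff (scale (- t) y ⊟ scale t x) w + coeff (scale t z) w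
    ≡⟨ coeff-⊞ (scale (- t) y ⊟ scale t x) (scale t z) w ⟨
  coeff ((scale (- t) y ⊟ scale t x) ⊞ scale t z) w
    ∎
  where
  open ≡-Reasoning
  X Y Z : ℚ
  X = coeff x w
  Y = coeff y w
  Z = coeff z w
  ring : ∀ t X Y Z → - t * ((X + Y) + - Z) ≡ (- t * Y + - (t * X)) + t * Z
  ring = solve-∀ ℚ-ring

⊞-rearrange : ∀ a₀ a b b′ c → ⊟ a₀ ⊞ (((b ⊟ a) ⊞ c) ⊞ b′) ≋ ((b ⊞ b′) ⊟ (a₀ ⊞ a)) ⊞ c
⊞-rearrange a₀ a b b′ c .coeff-≡ w = begin
  coeff (⊟ a₀ ⊞ (((b ⊟ a) ⊞ c) ⊞ b′)) w
    ≡⟨ coeff-⊞ (⊟ a₀) _ w ⟩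
  coeff (⊟ a₀) w + coeff (((b ⊟ a) ⊞ c) ⊞ b′) w
    ≡⟨ cong₂ _+_ (coeff-neg a₀ w)
         (trans (coeff-⊞ ((b ⊟ a) ⊞ c) b′ w)
           (cong (_+ B′) (trans (coeff-⊞ (b ⊟ a) c w) (cong (_+ C) (coeff-⊟ b a w))))) ⟩
  - A₀ + (((B + - A) + C) + B′)
    ≡⟨ ring A₀ A B B′ C ⟩
  ((B + B′) + - (A₀ + A)) + C
    ≡⟨ cong (_+ C) (cong₂ (λ u v → u + - v) (coeff-⊞ b b′ w) (coeff-⊞ a₀ a w)) ⟨
  (coeff (b ⊞ b′) w + - coeff (a₀ ⊞ a) w) + C
    ≡⟨ cong (_+ C) (coeff-⊟ (b ⊞ b′) (a₀ ⊞ a) w) ⟨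
  coeff ((b ⊞ b′) ⊟ (a₀ ⊞ a)) w + C
    ≡⟨ coeff-⊞ ((b ⊞ b′) ⊟ (a₀ ⊞ a)) c w ⟨
  coeff (((b ⊞ b′) ⊟ (a₀ ⊞ a)) ⊞ c) w
    ∎
  where
  open ≡-Reasoning
  A₀ A B B′ C : ℚ
  A₀ = coeff a₀ w
  A  = coeff a w
  B  = coeff b w
  B′ = coeff b′ w
  C  = coeff c w
  ring : ∀ A₀ A B B′ C → - A₀ + (((B + - A) + C) + B′) ≡ ((B + B′) + - (A₀ + A)) + C
  ring = solve-∀ ℚ-ring

coeff-xmul-∷ : ∀ a p w → coeff (xmul a p) (a ∷ w) ≡ coeff p w
coeff-xmul-∷ a []            w = refl
coeff-xmul-∷ a ((q , u) ∷ p) w = by-cases (≡-dec ℕ._≟_ u w)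
  -- Not by `with`: ≡-dec (a ∷ u) (a ∷ w) reduces to a term containing ≡-dec u w,
  -- which `with` would abstract as well.
  where
  by-cases : Dec (u ≡ w) → coeff (xmul a ((q , u) ∷ p)) (a ∷ w) ≡ coeff ((q , u) ∷ p) w
  by-cases (yes u≡w) = begin
    coeff ((q , a ∷ u) ∷ xmul a p) (a ∷ w) ≡⟨ coeff-∷-≡ q (a ∷ u) (a ∷ w) (xmul a p) (cong (a ∷_) u≡w) ⟩
    q + coeff (xmul a p) (a ∷ w)           ≡⟨ cong (q +_) (coeff-xmul-∷ a p w) ⟩
    q + coeff p w                          ≡⟨ coeff-∷-≡ q u w p u≡w ⟨
    coeff ((q , u) ∷ p) w                  ∎
    where open ≡-Reasoning
  by-cases (no u≢w) = begin
    coeff ((q , a ∷ u) ∷ xmul a p) (a ∷ w) ≡⟨ coeff-∷-≢ q (a ∷ u) (a ∷ w) (xmul a p) (u≢w ∘ List.∷-injectiveʳ) ⟩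
    coeff (xmul a p) (a ∷ w)               ≡⟨ coeff-xmul-∷ a p w ⟩
    coeff p w                              ≡⟨ coeff-∷-≢ q u w p u≢w ⟨
    coeff ((q , u) ∷ p) w                  ∎
    where open ≡-Reasoning

coeff-xmul-∉ : ∀ a p v → (∀ w → a ∷ w ≢ v) → coeff (xmul a p) v ≡ 0ℚ
coeff-xmul-∉ a []            v _   = refl
coeff-xmul-∉ a ((q , u) ∷ p) v a∉v = trans (coeff-∷-≢ q (a ∷ u) v (xmul a p) (a∉v u)) (coeff-xmul-∉ a p v a∉v)

xmul-cong : ∀ a {p r} → p ≋ r → xmul a p ≋ xmul a r
xmul-cong a {p} {r} p≋r .coeff-≡ [] =
  trans (coeff-xmul-∉ a p [] (λ _ ())) (sym (coeff-xmul-∉ a r [] (λ _ ())))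
xmul-cong a {p} {r} p≋r .coeff-≡ (b ∷ w) with a ℕ.≟ b
... | yes refl = trans (coeff-xmul-∷ a p w) (trans (p≋r .coeff-≡ w) (sym (coeff-xmul-∷ a r w)))
... | no a≢b   = trans (coeff-xmul-∉ a p (b ∷ w) a∉) (sym (coeff-xmul-∉ a r (b ∷ w) a∉))
  where
  a∉ : ∀ w′ → a ∷ w′ ≢ b ∷ w
  a∉ w′ = a≢b ∘ List.∷-injectiveˡ

xmul-⊞ : ∀ a p r → xmul a (p ⊞ r) ≡ xmul a p ⊞ xmul a r
xmul-⊞ a p r = List.map-++ _ p r

xmul-scale : ∀ a t p → xmul a (scale t p) ≡ scale t (xmul a p)
xmul-scale a t []            = refl
xmul-scale a t ((q , u) ∷ p) = cong ((t * q , a ∷ u) ∷_) (xmul-scale a t p)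

xmul-sumUpTo : ∀ a n g → xmul a (sumUpTo n g) ≡ sumUpTo n (λ i → xmul a (g i))
xmul-sumUpTo a zero    g = refl
xmul-sumUpTo a (suc n) g = trans (xmul-⊞ a (sumUpTo n g) (g (suc n))) (cong (_⊞ xmul a (g (suc n))) (xmul-sumUpTo a n g))

sumUpTo-peel : ∀ n g → sumUpTo (suc n) g ≡ g 0 ⊞ sumUpTo n (λ i → g (suc i))
sumUpTo-peel zero    g = refl
sumUpTo-peel (suc n) g =
  trans (cong (_⊞ g (suc (suc n))) (sumUpTo-peel n g)) (List.++-assoc (g 0) _ (g (suc (suc n))))

sumUpTo-cong : ∀ n {g h} → (∀ i → i ≤ n → g i ≋ h i) → sumUpTo n g ≋ sumUpTo n h
sumUpTo-cong zero    g≋h = g≋h 0 z≤n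
sumUpTo-cong (suc n) g≋h =
  ⊞-cong (sumUpTo-cong n (λ i i≤n → g≋h i (ℕ.m≤n⇒m≤1+n i≤n))) (g≋h (suc n) ℕ.≤-refl)

sumUpTo-⊞ : ∀ n g h → sumUpTo n (λ i → g i ⊞ h i) ≋ sumUpTo n g ⊞ sumUpTo n h
sumUpTo-⊞ zero    g h = ≋-refl
sumUpTo-⊞ (suc n) g h .coeff-≡ w = begin
  coeff (sumUpTo n (λ i → g i ⊞ h i) ⊞ (g (suc n) ⊞ h (suc n))) w
    ≡⟨ coeff-⊞ (sumUpTo n _) _ w ⟩
  coeff (sumUpTo n (λ i → g i ⊞ h i)) w + coeff (g (suc n) ⊞ h (suc n)) w
    ≡⟨ cong₂ _+_ (trans (sumUpTo-⊞ n g h .coeff-≡ w) (coeff-⊞ (sumUpTo n g) _ w)) (coeff-⊞ (g (suc n)) _ w) ⟩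
  (coeff (sumUpTo n g) w + coeff (sumUpTo n h) w) + (coeff (g (suc n)) w + coeff (h (suc n)) w)
    ≡⟨ ring (coeff (sumUpTo n g) w) _ _ _ ⟩
  (coeff (sumUpTo n g) w + coeff (g (suc n)) w) + (coeff (sumUpTo n h) w + coeff (h (suc n)) w)
    ≡⟨ cong₂ _+_ (coeff-⊞ (sumUpTo n g) _ w) (coeff-⊞ (sumUpTo n h) _ w) ⟨
  coeff (sumUpTo (suc n) g) w + coeff (sumUpTo (suc n) h) w
    ≡⟨ coeff-⊞ (sumUpTo (suc n) g) _ w ⟨
  coeff (sumUpTo (suc n) g ⊞ sumUpTo (suc n) h) w
    ∎
  where
  open ≡-Reasoning
  ring : ∀ a b c d → (a + b) + (c + d) ≡ (a + c) + (b + d)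
  ring = solve-∀ ℚ-ring

sumUpTo-⊟ : ∀ n g → sumUpTo n (λ i → ⊟ g i) ≡ ⊟ sumUpTo n g
sumUpTo-⊟ zero    g = refl
sumUpTo-⊟ (suc n) g = trans (cong (_⊞ ⊟ g (suc n)) (sumUpTo-⊟ n g)) (sym (List.map-++ _ (sumUpTo n g) (g (suc n))))

sumUpTo-linear : ∀ n g h k →
  sumUpTo n (λ i → (g i ⊟ h i) ⊞ k i) ≋ (sumUpTo n g ⊟ sumUpTo n h) ⊞ sumUpTo n k
sumUpTo-linear n g h k = begin
  sumUpTo n (λ i → (g i ⊟ h i) ⊞ k i)                   ≈⟨ sumUpTo-⊞ n (λ i → g i ⊟ h i) k ⟩
  sumUpTo n (λ i → g i ⊟ h i) ⊞ sumUpTo n k             ≈⟨ ⊞-cong (sumUpTo-⊞ n g (λ i → ⊟ h i)) ≋-refl ⟩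
  (sumUpTo n g ⊞ sumUpTo n (λ i → ⊟ h i)) ⊞ sumUpTo n k ≡⟨ cong (λ x → (sumUpTo n g ⊞ x) ⊞ sumUpTo n k) (sumUpTo-⊟ n h) ⟩
  (sumUpTo n g ⊟ sumUpTo n h) ⊞ sumUpTo n k             ∎
  where open ≋-Reasoning

length-∷ʳ : ∀ (m : Word) p → length (m ∷ʳ p) ≡ suc (length m)
length-∷ʳ []      p = refl
length-∷ʳ (x ∷ m) p = cong suc (length-∷ʳ m p)

take-∷ʳ : ∀ {j} (m : Word) p → j ≤ length m → take j (m ∷ʳ p) ≡ take j m
take-∷ʳ {zero}  m       p _           = refl
take-∷ʳ {suc j} (x ∷ m) p (s≤s j≤m) = cong (x ∷_) (take-∷ʳ m p j≤m)

drop-∷ʳ : ∀ {j} (m : Word) p → j ≤ length m → drop j (m ∷ʳ p) ≡ drop j m ∷ʳ p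
drop-∷ʳ {zero}  m       p _           = refl
drop-∷ʳ {suc j} (x ∷ m) p (s≤s j≤m) = drop-∷ʳ m p j≤m

signW-∷ʳ : ∀ v p → signW (v ∷ʳ p) ≡ - signW v
signW-∷ʳ []      p = refl
signW-∷ʳ (x ∷ v) p = cong -_ (signW-∷ʳ v p)

splitTerm : Letter → Word → Word → 𝔛
splitTerm c u v = scale (signW v) (fw c (reverse v) u)

f-S-mono : ∀ c u v → f c (S (mono v)) (mono u) ≡ splitTerm c u v
f-S-mono c u v =
  trans (List.++-identityʳ _)
    (trans (List.++-identityʳ _)
      (cong (λ t → scale t (fw c (reverse v) u)) (trans (*-identityʳ (1ℚ * signW v)) (*-identityˡ (signW v)))))

alternatingSum : Letter → Word → 𝔛
alternatingSum c w = sumUpTo (length w) (λ i → splitTerm c (take i w) (drop i w))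

fw-[] : ∀ c u → fw c u [] ≡ mono (c ∷ u)
fw-[] c []      = refl
fw-[] c (a ∷ u) = refl

splitTerm-∷ʳ : ∀ c u v p → splitTerm c u (v ∷ʳ p) ≡ scale (- signW v) (fw c (p ∷ reverse v) u)
splitTerm-∷ʳ c u v p = cong₂ (λ t r → scale t (fw c r u)) (signW-∷ʳ v p) (List.reverse-++ v (p ∷ []))

splitTerm-step : ∀ c p q u v →
  splitTerm c (q ∷ u) (v ∷ʳ p) ≋
    (xmul c (splitTerm q u (v ∷ʳ p)) ⊟ xmul c (splitTerm p (q ∷ u) v)) ⊞ splitTerm ((c ⊕ p) ⊕ q) u v
splitTerm-step c p q u v = begin
  splitTerm c (q ∷ u) (v ∷ʳ p)
    ≡⟨ splitTerm-∷ʳ c (q ∷ u) v p ⟩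
  scale (- σ) ((xmul c x ⊞ xmul c y) ⊟ z)
    ≈⟨ scale-neg-regroup σ (xmul c x) (xmul c y) z ⟩
  (scale (- σ) (xmul c y) ⊟ scale σ (xmul c x)) ⊞ scale σ z
    ≡⟨ cong₂ (λ s t → (s ⊟ t) ⊞ scale σ z) (xmul-scale c (- σ) y) (xmul-scale c σ x) ⟨
  (xmul c (scale (- σ) y) ⊟ xmul c (scale σ x)) ⊞ scale σ z
    ≡⟨ cong (λ s → (xmul c s ⊟ xmul c (scale σ x)) ⊞ scale σ z) (splitTerm-∷ʳ q u v p) ⟨
  (xmul c (splitTerm q u (v ∷ʳ p)) ⊟ xmul c (splitTerm p (q ∷ u) v)) ⊞ splitTerm ((c ⊕ p) ⊕ q) u v
    ∎
  where
  open ≋-Reasoning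
  σ : ℚ
  σ = signW v
  x y z : 𝔛
  x = fw p (reverse v) (q ∷ u)
  y = fw q (p ∷ reverse v) u
  z = fw ((c ⊕ p) ⊕ q) (reverse v) u

splitTerm-first : ∀ c p v → splitTerm c [] (v ∷ʳ p) ≋ ⊟ xmul c (splitTerm p [] v)
splitTerm-first c p v = begin
  splitTerm c [] (v ∷ʳ p)                         ≡⟨ splitTerm-∷ʳ c [] v p ⟩
  scale (- signW v) (mono (c ∷ p ∷ reverse v))    ≈⟨ scale-neg (signW v) _ ⟩
  ⊟ scale (signW v) (mono (c ∷ p ∷ reverse v))    ≡⟨ cong (λ r → ⊟ xmul c (scale (signW v) r)) (fw-[] p (reverse v)) ⟨
  ⊟ xmul c (splitTerm p [] v)                     ∎
  where open ≋-Reasoning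

splitTerm-last : ∀ c q u d → d ≡ [] → splitTerm c (q ∷ u) d ≡ xmul c (splitTerm q u d)
splitTerm-last c q u .[] refl = refl

alternatingSum-∷ʳ : ∀ c p q m →
  alternatingSum c ((q ∷ m) ∷ʳ p) ≋
    (xmul c (alternatingSum q (m ∷ʳ p)) ⊟ xmul c (alternatingSum p (q ∷ m)))
      ⊞ alternatingSum ((c ⊕ p) ⊕ q) m
alternatingSum-∷ʳ c p q m = begin
  alternatingSum c (q ∷ l)
    ≡⟨ sumUpTo-peel (length l) g ⟩
  g 0 ⊞ sumUpTo (length l) (λ j → g (suc j))
    ≡⟨ cong (λ k → g 0 ⊞ sumUpTo k (λ j → g (suc j))) (length-∷ʳ m p) ⟩
  g 0 ⊞ (sumUpTo n (λ j → g (suc j)) ⊞ g (suc (suc n)))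
    ≈⟨ ⊞-cong (splitTerm-first c p (q ∷ m)) (⊞-cong middle (≋-reflexive last)) ⟩
  ⊟ xmul c (hA 0) ⊞ (((xmul c ΣB ⊟ xmul c ΣA) ⊞ ΣC) ⊞ xmul c (hB (suc n)))
    ≈⟨ ⊞-rearrange (xmul c (hA 0)) (xmul c ΣA) (xmul c ΣB) (xmul c (hB (suc n))) ΣC ⟩
  ((xmul c ΣB ⊞ xmul c (hB (suc n))) ⊟ (xmul c (hA 0) ⊞ xmul c ΣA)) ⊞ ΣC
    ≡⟨ cong₂ (λ b a → (b ⊟ a) ⊞ ΣC) B-split A-split ⟨
  (xmul c (alternatingSum q l) ⊟ xmul c (alternatingSum p (q ∷ m))) ⊞ ΣC
    ∎
  where
  open ≋-Reasoning
  l : Word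
  l = m ∷ʳ p
  n : ℕ
  n = length m
  g hA hB hC : ℕ → 𝔛
  g  i = splitTerm c (take i (q ∷ l)) (drop i (q ∷ l))
  hA i = splitTerm p (take i (q ∷ m)) (drop i (q ∷ m))
  hB i = splitTerm q (take i l) (drop i l)
  hC i = splitTerm ((c ⊕ p) ⊕ q) (take i m) (drop i m)
  ΣA ΣB ΣC : 𝔛
  ΣA = sumUpTo n (λ j → hA (suc j))
  ΣB = sumUpTo n hB
  ΣC = sumUpTo n hC

  middle-term : ∀ j → j ≤ n → g (suc j) ≋ (xmul c (hB j) ⊟ xmul c (hA (suc j))) ⊞ hC j
  middle-term j j≤n rewrite take-∷ʳ m p j≤n | drop-∷ʳ m p j≤n =
    splitTerm-step c p q (take j m) (drop j m)

  middle : sumUpTo n (λ j → g (suc j)) ≋ (xmul c ΣB ⊟ xmul c ΣA) ⊞ ΣC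
  middle = begin
    sumUpTo n (λ j → g (suc j))
      ≈⟨ sumUpTo-cong n middle-term ⟩
    sumUpTo n (λ j → (xmul c (hB j) ⊟ xmul c (hA (suc j))) ⊞ hC j)
      ≈⟨ sumUpTo-linear n (λ j → xmul c (hB j)) (λ j → xmul c (hA (suc j))) hC ⟩
    (sumUpTo n (λ j → xmul c (hB j)) ⊟ sumUpTo n (λ j → xmul c (hA (suc j)))) ⊞ ΣC
      ≡⟨ cong₂ (λ b a → (b ⊟ a) ⊞ ΣC) (xmul-sumUpTo c n hB) (xmul-sumUpTo c n (λ j → hA (suc j))) ⟨
    (xmul c ΣB ⊟ xmul c ΣA) ⊞ ΣC
      ∎

  last : g (suc (suc n)) ≡ xmul c (hB (suc n))
  last = splitTerm-last c q (take (suc n) l) (drop (suc n) l)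
           (List.drop-all (suc n) l (ℕ.≤-reflexive (length-∷ʳ m p)))

  B-split : xmul c (alternatingSum q l) ≡ xmul c ΣB ⊞ xmul c (hB (suc n))
  B-split = trans (cong (λ k → xmul c (sumUpTo k hB)) (length-∷ʳ m p)) (xmul-⊞ c ΣB (hB (suc n)))

  A-split : xmul c (alternatingSum p (q ∷ m)) ≡ xmul c (hA 0) ⊞ xmul c ΣA
  A-split = trans (cong (xmul c) (sumUpTo-peel n hA)) (xmul-⊞ c (hA 0) ΣA)

⊕-comm : ∀ a b → a ⊕ b ≡ b ⊕ a
⊕-comm a b = cong suc (ℕ.+-comm a b)

⊕-left-comm : ∀ a b c → a ⊕ (b ⊕ c) ≡ b ⊕ (a ⊕ c)
⊕-left-comm = arith
  where
  arith : ∀ a b c → suc (a ℕ+ suc (b ℕ+ c)) ≡ suc (b ℕ+ suc (a ℕ+ c))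
  arith = ℕ-Solver.solve-∀

foldr-⊕-shift : ∀ a c w → foldr _⊕_ (a ⊕ c) w ≡ a ⊕ foldr _⊕_ c w
foldr-⊕-shift a c []      = refl
foldr-⊕-shift a c (x ∷ w) = trans (cong (x ⊕_) (foldr-⊕-shift a c w)) (⊕-left-comm x a _)

foldr-⊕-rotate : ∀ p q m → foldr _⊕_ q (m ∷ʳ p) ≡ foldr _⊕_ p (q ∷ m)
foldr-⊕-rotate p q m = begin
  foldr _⊕_ q (m ∷ʳ p)   ≡⟨ List.foldr-∷ʳ _⊕_ q p m ⟩
  foldr _⊕_ (p ⊕ q) m    ≡⟨ cong (λ x → foldr _⊕_ x m) (⊕-comm p q) ⟩
  foldr _⊕_ (q ⊕ p) m    ≡⟨ foldr-⊕-shift q p m ⟩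
  q ⊕ foldr _⊕_ p m      ∎
  where open ≡-Reasoning

foldr-⊕-ends : ∀ c p q m → foldr _⊕_ ((c ⊕ p) ⊕ q) m ≡ foldr _⊕_ c ((q ∷ m) ∷ʳ p)
foldr-⊕-ends c p q m = begin
  foldr _⊕_ ((c ⊕ p) ⊕ q) m   ≡⟨ cong (λ x → foldr _⊕_ x m) (trans (⊕-comm (c ⊕ p) q) (cong (q ⊕_) (⊕-comm c p))) ⟩
  foldr _⊕_ (q ⊕ (p ⊕ c)) m   ≡⟨ foldr-⊕-shift q (p ⊕ c) m ⟩
  q ⊕ foldr _⊕_ (p ⊕ c) m     ≡⟨ cong (q ⊕_) (List.foldr-∷ʳ _⊕_ c p m) ⟨
  q ⊕ foldr _⊕_ c (m ∷ʳ p)    ∎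
  where open ≡-Reasoning

whenEven : ℕ → 𝔛 → 𝔛
whenEven zero          p = p
whenEven (suc zero)    p = 𝟘
whenEven (suc (suc n)) p = whenEven n p

whenEven-even : ∀ n p → n % 2 ≡ 0 → whenEven n p ≡ p
whenEven-even zero          p _      = refl
whenEven-even (suc (suc n)) p n%2≡0 = whenEven-even n p n%2≡0

whenEven-odd : ∀ n p → n % 2 ≡ 1 → whenEven n p ≡ 𝟘
whenEven-odd (suc zero)    p _      = refl
whenEven-odd (suc (suc n)) p n%2≡1 = whenEven-odd n p n%2≡1

ClosedFormAt : ℕ → Set
ClosedFormAt n = ∀ c w → length w ≡ n → alternatingSum c w ≋ whenEven n (mono (foldr _⊕_ c w ∷ []))

closedForm-step : ∀ n → ClosedFormAt n → ClosedFormAt (suc n) → ClosedFormAt (suc (suc n))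
closedForm-step n closedAt-n closedAt-1+n c w = by-view (reverseView w)
  where
  by-view : ∀ {w} → Reverse w → length w ≡ suc (suc n) →
    alternatingSum c w ≋ whenEven (suc (suc n)) (mono (foldr _⊕_ c w ∷ []))
  by-view [] ()
  by-view ([] ∶ _ ∶ʳ a) ()
  by-view ((q ∷ m) ∶ _ ∶ʳ p) ℓ = begin
    alternatingSum c ((q ∷ m) ∷ʳ p)
      ≈⟨ alternatingSum-∷ʳ c p q m ⟩
    (xmul c (alternatingSum q (m ∷ʳ p)) ⊟ xmul c (alternatingSum p (q ∷ m))) ⊞ alternatingSum c′ m
      ≈⟨ ⊟-cancelˡ (alternatingSum c′ m) (xmul-cong c (≋-trans B-closed (≋-sym A-closed))) ⟩
    alternatingSum c′ m
      ≈⟨ closedAt-n c′ m m-length ⟩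
    whenEven n (mono (foldr _⊕_ c′ m ∷ []))
      ≡⟨ cong (λ x → whenEven n (mono (x ∷ []))) (foldr-⊕-ends c p q m) ⟩
    whenEven n (mono (foldr _⊕_ c ((q ∷ m) ∷ʳ p) ∷ []))
      ∎
    where
    open ≋-Reasoning
    c′ : Letter
    c′ = (c ⊕ p) ⊕ q
    m-length : length m ≡ n
    m-length = ℕ.suc-injective (ℕ.suc-injective (trans (cong suc (sym (length-∷ʳ m p))) ℓ))
    A-closed : alternatingSum p (q ∷ m) ≋ whenEven (suc n) (mono (foldr _⊕_ p (q ∷ m) ∷ []))
    A-closed = closedAt-1+n p (q ∷ m) (cong suc m-length)
    B-closed : alternatingSum q (m ∷ʳ p) ≋ whenEven (suc n) (mono (foldr _⊕_ p (q ∷ m) ∷ []))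
    B-closed = ≋-trans
      (closedAt-1+n q (m ∷ʳ p) (trans (length-∷ʳ m p) (cong suc m-length)))
      (≋-reflexive (cong (λ x → whenEven (suc n) (mono (x ∷ []))) (foldr-⊕-rotate p q m)))

alternatingSum-closedForm : ∀ n → ClosedFormAt n
alternatingSum-closedForm zero c [] refl .coeff-≡ w =
  cong (λ t → coeff ((t , c ∷ []) ∷ []) w) (*-identityʳ 1ℚ)
alternatingSum-closedForm (suc zero) c (a ∷ []) refl =
  ≋-trans (⊞-cong (scale-neg 1ℚ (mono (c ∷ a ∷ []))) ≋-refl) (⊞-inverseˡ (scale 1ℚ (mono (c ∷ a ∷ []))))
alternatingSum-closedForm (suc (suc n)) =
  closedForm-step n (alternatingSum-closedForm n) (alternatingSum-closedForm (suc n))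

lemma2p4 : (c : Letter) (as : List Letter) →
    ((length as % 2 ≡ 0) →
      sumUpTo (length as) (λ i → f c (S (mono (drop i as))) (mono (take i as)))
        ≈ mono (foldr _⊕_ c as ∷ []))
    × ((length as % 2 ≡ 1) →
      sumUpTo (length as) (λ i → f c (S (mono (drop i as))) (mono (take i as)))
        ≈ 𝟘)
lemma2p4 c as =
  (λ even → ≋-trans sum≋closed (≋-reflexive (whenEven-even n _ even)) .coeff-≡) ,
  (λ odd  → ≋-trans sum≋closed (≋-reflexive (whenEven-odd n _ odd)) .coeff-≡)
  where
  n : ℕ
  n = length as
  sum≋closed : sumUpTo n (λ i → f c (S (mono (drop i as))) (mono (take i as)))
             ≋ whenEven n (mono (foldr _⊕_ c as ∷ []))
  sum≋closed = ≋-trans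
    (sumUpTo-cong n (λ i _ → ≋-reflexive (f-S-mono c (take i as) (drop i as))))
    (alternatingSum-closedForm n c as refl)
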